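{- Let $I=(G=(V,E),\mathcal{C},\omega,\ell,b)$ be an instance of \textsc{Stars NWS} and $E^*\subseteq E$. Let $C\in\mathcal{C}$ be a community containing no local edge (no edge of $E^*$ has both endpoints in $C$), and let $D\in\mathcal{C}$ with $|C\cap D|\ge 2$. Then for every solution $G'$ with $\mathrm{univ}_{G'}(C)\not\subseteq C\cap D$, the communities $C$ and $D$ induce a local cycle in $G'$ that uses at least one edge not in $E^*$.
   Context: A solution of \textsc{Stars NWS} is a spanning subgraph $G'=(V,E')$, $E'\subseteq E$, $|E'|\le\ell$, $\omega(E')\le b$, such that for each $C\in\mathcal{C}$ the set $\mathrm{univ}_{G'}(C)$ of vertices $u\in C$ adjacent in $G'$ to all of $C\setminus\{u\}$ is nonempty. Edges of $E^*$ are called local edges. Two communities $C_1,C_2$ induce a local cycle in $G'$ if there are $c_i\in\mathrm{univ}_{G'}(C_i)$ ($i=1,2$) such that the graph on $C_1\cup C_2$ with edges $\{\{c_i,w\}: w\in C_i\setminus\{c_i\}, i\in\{1,2\}\}$ contains a cycle; such cycles are local cycles. -}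

module Defs where

open import Data.Nat using (ℕ; _≤_; _+_; _<ᵇ_)
open import Data.Bool using (Bool; true; false; _∧_; if_then_else_)
open import Data.Fin using (Fin; toℕ)
open import Data.Fin.Subset using (Subset; _∈_; _∉_; _∩_; ∣_∣)
open import Data.List using (List; []; _∷_; _++_; map; concatMap; length; allFin)
open import Data.Nat.ListAction using (sum)
open import Data.List.Membership.Propositional renaming (_∈_ to _∈ₗ_)
open import Data.List.Relation.Unary.All using (All)
open import Data.List.Relation.Unary.Any using (Any)
open import Data.List.Relation.Unary.Unique.Propositional using (Unique)
open import Data.Product using (_×_; _,_; Σ; ∃; ∃-syntax)
open import Data.Sum using (_⊎_)
open import Relation.Binary.PropositionalEquality using (_≡_; _≢_)
open import Relation.Nullary using (¬_)

record Graph (n : ℕ) : Set where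
  field
    adj   : Fin n → Fin n → Bool
    sym   : ∀ u v → adj u v ≡ adj v u
    irrefl : ∀ u → adj u u ≡ false
open Graph public

Adj : ∀ {n} → Graph n → Fin n → Fin n → Set
Adj H u v = adj H u v ≡ true

_⊆ᴱ_ : ∀ {n} → Graph n → Graph n → Set
H ⊆ᴱ K = ∀ u v → Adj H u v → Adj K u v

pairs : (n : ℕ) → List (Fin n × Fin n)
pairs n = concatMap (λ i → map (λ j → (i , j)) (allFin n)) (allFin n)

-- is (i , j) with i < j an edge of H (each unordered edge counted once)
isEdge : ∀ {n} → Graph n → Fin n × Fin n → Bool
isEdge H (i , j) = (toℕ i <ᵇ toℕ j) ∧ adj H i j

edgeCount : ∀ {n} → Graph n → ℕ
edgeCount {n} H = sum (map (λ p → if isEdge H p then 1 else 0) (pairs n))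

-- total weight ω(E(H)), ω given as a (symmetric) weight function on pairs
weight : ∀ {n} → (Fin n → Fin n → ℕ) → Graph n → ℕ
weight {n} ω H =
  sum (map (λ { (i , j) → if isEdge H (i , j) then ω i j else 0 }) (pairs n))

record Instance : Set where
  field
    n     : ℕ
    G     : Graph n
    𝒞     : List (Subset n)
    ω     : Fin n → Fin n → ℕ
    ℓ     : ℕ
    b     : ℕ
open Instance public

IsUniv : ∀ {n} → Graph n → Subset n → Fin n → Set
IsUniv H C u = u ∈ C × (∀ w → w ∈ C → w ≢ u → Adj H u w)

record Solution (I : Instance) : Set where
  field
    G'       : Graph (n I)
    sub      : G' ⊆ᴱ G I
    size     : edgeCount G' ≤ ℓ I
    budget   : weight (ω I) G' ≤ b I
    hasUniv  : ∀ C → C ∈ₗ 𝒞 I → ∃[ u ] IsUniv G' C u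
open Solution public

-- Edges of the star graph on C₁ ∪ C₂ with centers c₁, c₂:
-- {c_i , w} for w ∈ C_i ∖ {c_i}, i ∈ {1,2}.
StarEdge1 : ∀ {n} → Fin n → Subset n → Fin n → Fin n → Set
StarEdge1 c C u v = (u ≡ c × v ∈ C × v ≢ c) ⊎ (v ≡ c × u ∈ C × u ≢ c)

StarEdge : ∀ {n} → Fin n → Subset n → Fin n → Subset n → Fin n → Fin n → Set
StarEdge c₁ C₁ c₂ C₂ u v = StarEdge1 c₁ C₁ u v ⊎ StarEdge1 c₂ C₂ u v

consecutive : ∀ {A : Set} → List A → List (A × A)
consecutive []           = []
consecutive (x ∷ [])     = []
consecutive (x ∷ y ∷ xs) = (x , y) ∷ consecutive (y ∷ xs)

cycleEdges : ∀ {A : Set} → A → List A → List (A × A)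
cycleEdges v vs = consecutive (v ∷ vs ++ v ∷ [])

IsCycle : ∀ {A : Set} → (A → A → Set) → A → List A → Set
IsCycle R v vs =
  2 ≤ length vs × Unique (v ∷ vs) × All (λ { (x , y) → R x y }) (cycleEdges v vs)

LocalCycleWithNonLocalEdge : ∀ {n} → Graph n → Graph n → Subset n → Subset n → Set
LocalCycleWithNonLocalEdge {n} G' E* C₁ C₂ =
  Σ (Fin n) λ c₁ → Σ (Fin n) λ c₂ → IsUniv G' C₁ c₁ × IsUniv G' C₂ c₂ ×
  Σ (Fin n) λ v → Σ (List (Fin n)) λ vs →
    IsCycle (StarEdge c₁ C₁ c₂ C₂) v vs ×
    Any (λ { (x , y) → ¬ Adj E* x y }) (cycleEdges v vs)

{-# OPTIONS --safe #-}
module Submission where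

-- Pick c₁ ∈ univ(C) outside C ∩ D (so c₁ ∉ D), any c₂ ∈ univ(D) and two
-- distinct x, y ∈ C ∩ D. The stars around c₁ in C and c₂ in D close the
-- cycle c₁ x c₂ y, which degenerates to the triangle c₁ x y when c₂ ∈ {x, y}.
-- Its first edge c₁x lies inside C, hence is not in E*.

open import Defs
open import Data.Nat using (ℕ; _≤_; s≤s; z≤n)
open import Data.Fin using (Fin; zero; suc; _≟_)
open import Data.Fin.Properties using (suc-injective; all?; ¬∀⟶∃¬)
open import Data.Fin.Subset using (Subset; _∈_; _∉_; _∩_; ∣_∣; Nonempty; inside; outside)
open import Data.Fin.Subset.Properties using (_∈?_; x∈p∩q⁺; x∈p∩q⁻)
open import Data.Vec.Base using (_∷_; here; there)
open import Data.Bool.Properties using () renaming (_≟_ to _≟ᵇ_)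
open import Data.Bool using (true)
open import Data.Product using (_×_; _,_; ∃-syntax; ∃₂)
open import Data.Sum using (inj₁; inj₂)
open import Data.List using ([]; _∷_)
open import Data.List.Membership.Propositional using () renaming (_∈_ to _∈ₗ_)
open import Data.List.Relation.Unary.All using ([]; _∷_)
open import Data.List.Relation.Unary.Any using (here)
open import Data.List.Relation.Unary.AllPairs using ([]; _∷_)
open import Relation.Nullary using (¬_; Dec; yes; no; contradiction)
open import Relation.Nullary.Decidable using (_×-dec_; _→-dec_; ¬?)
open import Relation.Unary using (Decidable)
open import Relation.Binary.PropositionalEquality using (_≢_; refl; ≢-sym)

private
  variable
    m : ℕ
    A B : Set
    p C₁ C₂ : Subset m
    c c₁ c₂ u v x y : Fin m

¬[A→B]⇒A×¬B : Dec A → ¬ (A → B) → A × ¬ B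
¬[A→B]⇒A×¬B (yes a) ¬[A→B] = a , λ b → ¬[A→B] (λ _ → b)
¬[A→B]⇒A×¬B (no ¬a) ¬[A→B] = contradiction (λ a → contradiction a ¬a) ¬[A→B]

1≤∣p∣⇒Nonempty : 1 ≤ ∣ p ∣ → Nonempty p
1≤∣p∣⇒Nonempty {p = inside  ∷ p} _      = zero , here
1≤∣p∣⇒Nonempty {p = outside ∷ p} 1≤∣p∣ with x , x∈p ← 1≤∣p∣⇒Nonempty 1≤∣p∣ =
  suc x , there x∈p

2≤∣p∣⇒∃-distinct : 2 ≤ ∣ p ∣ → ∃₂ λ x y → x ≢ y × x ∈ p × y ∈ p
2≤∣p∣⇒∃-distinct {p = inside ∷ p} (s≤s 1≤∣p∣) with y , y∈p ← 1≤∣p∣⇒Nonempty 1≤∣p∣ =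
  zero , suc y , (λ ()) , here , there y∈p
2≤∣p∣⇒∃-distinct {p = outside ∷ p} 2≤∣p∣
  with x , y , x≢y , x∈p , y∈p ← 2≤∣p∣⇒∃-distinct 2≤∣p∣ =
  suc x , suc y , (λ sx≡sy → x≢y (suc-injective sx≡sy)) , there x∈p , there y∈p

∉∧∈⇒≢ : x ∉ p → y ∈ p → x ≢ y
∉∧∈⇒≢ x∉p y∈p refl = x∉p y∈p

IsUniv? : (H : Graph m) (C : Subset m) → Decidable (IsUniv H C)
IsUniv? H C u =
  u ∈? C ×-dec all? (λ w → w ∈? C →-dec ¬? (w ≟ u) →-dec adj H u w ≟ᵇ true)

univ⊈⇒∃-univ-∉ : (H : Graph m) (C p : Subset m) →
  ¬ (∀ u → IsUniv H C u → u ∈ p) → ∃[ u ] IsUniv H C u × u ∉ p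
univ⊈⇒∃-univ-∉ {m} H C p univ⊈p
  with u , ¬[univ⇒∈] ← ¬∀⟶∃¬ m _ (λ u → IsUniv? H C u →-dec u ∈? p) univ⊈p =
  u , ¬[A→B]⇒A×¬B (IsUniv? H C u) ¬[univ⇒∈]

star-triangle : c ∉ C₂ → u ≢ v → u ∈ C₁ → u ∈ C₂ → v ∈ C₁ → v ∈ C₂ →
  IsCycle (StarEdge c C₁ u C₂) c (u ∷ v ∷ [])
star-triangle c∉C₂ u≢v u∈C₁ u∈C₂ v∈C₁ v∈C₂ =
  s≤s (s≤s z≤n) ,
  (c≢u ∷ c≢v ∷ []) ∷ (u≢v ∷ []) ∷ [] ∷ [] ,
  inj₁ (inj₁ (refl , u∈C₁ , ≢-sym c≢u)) ∷
  inj₂ (inj₁ (refl , v∈C₂ , ≢-sym u≢v)) ∷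
  inj₁ (inj₂ (refl , v∈C₁ , ≢-sym c≢v)) ∷ []
  where
  c≢u = ∉∧∈⇒≢ c∉C₂ u∈C₂
  c≢v = ∉∧∈⇒≢ c∉C₂ v∈C₂

star-square : c₁ ∉ C₂ → c₂ ∈ C₂ → x ≢ y → x ≢ c₂ → y ≢ c₂ →
  x ∈ C₁ → x ∈ C₂ → y ∈ C₁ → y ∈ C₂ →
  IsCycle (StarEdge c₁ C₁ c₂ C₂) c₁ (x ∷ c₂ ∷ y ∷ [])
star-square c₁∉C₂ c₂∈C₂ x≢y x≢c₂ y≢c₂ x∈C₁ x∈C₂ y∈C₁ y∈C₂ =
  s≤s (s≤s z≤n) ,
  (c₁≢x ∷ ∉∧∈⇒≢ c₁∉C₂ c₂∈C₂ ∷ c₁≢y ∷ []) ∷ (x≢c₂ ∷ x≢y ∷ []) ∷ (≢-sym y≢c₂ ∷ []) ∷ [] ∷ [] ,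
  inj₁ (inj₁ (refl , x∈C₁ , ≢-sym c₁≢x)) ∷
  inj₂ (inj₂ (refl , x∈C₂ , x≢c₂)) ∷
  inj₂ (inj₁ (refl , y∈C₂ , y≢c₂)) ∷
  inj₁ (inj₂ (refl , y∈C₁ , ≢-sym c₁≢y)) ∷ []
  where
  c₁≢x = ∉∧∈⇒≢ c₁∉C₂ x∈C₂
  c₁≢y = ∉∧∈⇒≢ c₁∉C₂ y∈C₂

two-stars-cycle : c₁ ∉ C₂ → c₂ ∈ C₂ → x ≢ y → x ∈ C₁ ∩ C₂ → y ∈ C₁ ∩ C₂ →
  ∃₂ λ z vs → z ∈ C₁ × IsCycle (StarEdge c₁ C₁ c₂ C₂) c₁ (z ∷ vs)
two-stars-cycle {C₂ = C₂} {c₂ = c₂} {x = x} {y = y} {C₁ = C₁}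
                c₁∉C₂ c₂∈C₂ x≢y x∈C₁∩C₂ y∈C₁∩C₂
  with x∈C₁ , x∈C₂ ← x∈p∩q⁻ C₁ C₂ x∈C₁∩C₂ | y∈C₁ , y∈C₂ ← x∈p∩q⁻ C₁ C₂ y∈C₁∩C₂
  with x ≟ c₂ | y ≟ c₂
... | yes refl | _ = x , _ , x∈C₁ , star-triangle c₁∉C₂ x≢y x∈C₁ x∈C₂ y∈C₁ y∈C₂
... | no _ | yes refl = y , _ , y∈C₁ , star-triangle c₁∉C₂ (≢-sym x≢y) y∈C₁ y∈C₂ x∈C₁ x∈C₂
... | no x≢c₂ | no y≢c₂ =
  x , _ , x∈C₁ , star-square c₁∉C₂ c₂∈C₂ x≢y x≢c₂ y≢c₂ x∈C₁ x∈C₂ y∈C₁ y∈C₂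

lemma14 : (I : Instance) (E* : Graph (n I)) → E* ⊆ᴱ G I →
    (C D : Subset (n I)) → C ∈ₗ 𝒞 I → D ∈ₗ 𝒞 I →
    (∀ u v → u ∈ C → v ∈ C → ¬ Adj E* u v) →
    2 ≤ ∣ C ∩ D ∣ →
    (S : Solution I) →
    ¬ (∀ u → IsUniv (G' S) C u → u ∈ C ∩ D) →
    LocalCycleWithNonLocalEdge (G' S) E* C D
lemma14 I E* _ C D _ D∈𝒞 C-has-no-local-edge 2≤∣C∩D∣ S univ⊈C∩D
  with c₁ , c₁-univ@(c₁∈C , _) , c₁∉C∩D ← univ⊈⇒∃-univ-∉ (G' S) C (C ∩ D) univ⊈C∩D
     | c₂ , c₂-univ@(c₂∈D , _) ← hasUniv S D D∈𝒞
     | x , y , x≢y , x∈C∩D , y∈C∩D ← 2≤∣p∣⇒∃-distinct 2≤∣C∩D∣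
  with z , vs , z∈C , cycle ← two-stars-cycle (λ c₁∈D → c₁∉C∩D (x∈p∩q⁺ (c₁∈C , c₁∈D)))
                                               c₂∈D x≢y x∈C∩D y∈C∩D =
  c₁ , c₂ , c₁-univ , c₂-univ , c₁ , z ∷ vs , cycle ,
  here (C-has-no-local-edge c₁ z c₁∈C z∈C)
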